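{- For nonnegative numbers $a,b,c,d$ with $a>b$, let $\mathcal{V}_n^{(a,b,c,d)}$ denote the set $\mathcal{V}_n$ of weighted Dyck paths of length $2n$ described in the context, with weight functions $$\alpha(x)=\frac{(a-b)x}{1-bx},\qquad \beta(x)=\frac{cx}{1-dx},\qquad \gamma(x)=\frac{(a-b)cx^2}{(1-bx)(1-dx)}.$$ Then there exist (weight-preserving) bijections between $\mathcal{V}_n^{(4,3,7,2)}$ and $\mathcal{V}_n^{(2,1,7,4)}$; between any two of $\mathcal{V}_n^{(5,4,4,1)}$, $\mathcal{V}_n^{(5,1,1,1)}$ and $\mathcal{V}_n^{(1,0,4,5)}$; and between $\mathcal{V}_n^{(3,2,8,3)}$ and $\mathcal{V}_n^{(3,1,4,3)}$.
   Context: A Dyck path of length $2n$ is a lattice path from $(0,0)$ to $(2n,0)$ with steps $\mathbf{u}=(1,1)$, $\mathbf{d}=(1,-1)$ never going below the $x$-axis. A valley is an occurrence of $\mathbf{du}$; its level is the ordinate of the common point of its two steps. A pyramid is a consecutive section $\mathbf{u}^h\mathbf{d}^h$ ($h\ge1$ its height); it is maximal if it cannot be extended to $\mathbf{u}^{h+1}\mathbf{d}^{h+1}$; its altitude is the ordinate of the endpoint of its last $\mathbf{d}$-step. A Dyck path is primitive if it is nonempty and touches the $x$-axis only at its endpoints. Given weight functions $\alpha(x)=\sum_{k\ge1}\alpha_kx^k$, $\beta(x)=\sum_{k\ge1}\beta_kx^k$, $\gamma(x)=\sum_{k\ge1}\gamma_kx^k$, let $\mathcal{A}_n$ be the set of primitive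 Dyck paths $P$ of length $2n$ all of whose valleys lie at the same level, weighted by: $w(\mathbf{u}^n\mathbf{d}^n)=\gamma_n$, and for $P=\mathbf{u}^k\mathbf{u}^{i_1}\mathbf{d}^{i_1}\cdots\mathbf{u}^{i_r}\mathbf{d}^{i_r}\mathbf{d}^k$ ($k\ge1$, $r\ge2$, $i_j\ge1$), $w(P)=\beta_k\alpha_{i_1}\cdots\alpha_{i_r}$; only paths of nonzero weight are kept. $\mathcal{V}_n$ is the set of Dyck paths of length $2n$ that are concatenations of zero or more paths from $\bigcup_{s\ge1}\mathcal{A}_s$, weighted by the product of the weights of the factors (empty path: weight $1$). Here all weights are nonnegative integers; a bijection between such weighted sets is understood in the weight-preserving sense, i.e. each path of weight $w$ is regarded as $w$ distinct copies (weighted objects), and the bijection is between these copies. -}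

module Defs where

open import Data.Nat using (ℕ; zero; suc; _+_; _*_; _∸_; _^_; _≤_)
open import Data.Integer as ℤ using (ℤ; 0ℤ; 1ℤ; -1ℤ)
open import Data.Bool using (Bool; true; false; _∧_; not; T)
open import Data.List using (List; []; _∷_; _++_; [_]; map; concatMap; replicate; length; upTo)
open import Data.List.Relation.Unary.All using (All)
open import Data.Nat.ListAction using (sum; product)
open import Data.Bool.ListAction using (and)
open import Data.Product using (Σ; _×_; _,_; proj₁; map₁)
open import Data.Fin using (Fin)
open import Relation.Nullary.Decidable using (⌊_⌋)
open import Relation.Binary.PropositionalEquality using (_≡_)

allL : {A : Set} → (A → Bool) → List A → Bool
allL p xs = and (map p xs)

-- Steps u = (1,1) and d = (1,-1); a lattice path is a list of steps.
data Step : Set where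
  U D : Step

Path : Set
Path = List Step

height : Path → ℤ
height []      = 0ℤ
height (U ∷ p) = 1ℤ ℤ.+ height p
height (D ∷ p) = -1ℤ ℤ.+ height p

splits : {A : Set} → List A → List (List A × List A)
splits []       = ([] , []) ∷ []
splits (x ∷ xs) = ([] , x ∷ xs) ∷ map (map₁ (x ∷_)) (splits xs)

nonempty : {A : Set} → List A → Bool
nonempty []      = false
nonempty (_ ∷ _) = true

isDyck : Path → Bool
isDyck p = allL (λ s → ⌊ 0ℤ ℤ.≤? height (proj₁ s) ⌋) (splits p) ∧ ⌊ height p ℤ.≟ 0ℤ ⌋

isPrimitive : Path → Bool
isPrimitive p = isDyck p ∧ nonempty p ∧
  allL (λ { (xs , ys) → not (nonempty xs ∧ nonempty ys ∧ ⌊ height xs ℤ.≟ 0ℤ ⌋) }) (splits p)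

valleyAt : Path × Path → List ℤ
valleyAt (xs , D ∷ U ∷ ys) = [ height (xs ++ [ D ]) ]
valleyAt _                 = []

valleyLevels : Path → List ℤ
valleyLevels p = concatMap valleyAt (splits p)

allSame : List ℤ → Bool
allSame []       = true
allSame (l ∷ ls) = allL (λ m → ⌊ m ℤ.≟ l ⌋) ls

sameLevelValleys : Path → Bool
sameLevelValleys p = allSame (valleyLevels p)

pyr : ℕ → Path
pyr h = replicate h U ++ replicate h D

-- Coefficients of the weight functions
--   α(x) = (a-b)x/(1-bx), β(x) = cx/(1-dx), γ(x) = (a-b)c x^2/((1-bx)(1-dx))
α : (a b c d : ℕ) → ℕ → ℕ
α a b c d zero    = 0
α a b c d (suc k) = (a ∸ b) * b ^ k

β : (a b c d : ℕ) → ℕ → ℕ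
β a b c d zero    = 0
β a b c d (suc k) = c * d ^ k

-- [x^(m+2)] γ(x) = (a-b) c Σ_{i+j=m} b^i d^j
γ : (a b c d : ℕ) → ℕ → ℕ
γ a b c d zero          = 0
γ a b c d (suc zero)    = 0
γ a b c d (suc (suc m)) = (a ∸ b) * c * sum (map (λ i → b ^ i * d ^ (m ∸ i)) (upTo (suc m)))

-- Weighted P w : the path P has weight w (as an element of some A_n)
data Weighted (a b c d : ℕ) : Path → ℕ → Set where
  pyramidW : ∀ n → Weighted a b c d (pyr n) (γ a b c d n)
  generalW : ∀ k (is : List ℕ) → 1 ≤ k → 2 ≤ length is → All (1 ≤_) is →
             Weighted a b c d (replicate k U ++ concatMap pyr is ++ replicate k D)
                              (β a b c d k * product (map (α a b c d) is))

-- weighted objects (copies) of A_s: a path P of A_s of weight w, together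
-- with one of its w copies
ACopy : (a b c d s : ℕ) → Set
ACopy a b c d s =
  Σ Path λ P → length P ≡ 2 * s × T (isPrimitive P) × T (sameLevelValleys P) ×
    Σ ℕ λ w → Weighted a b c d P w × Fin w

APath : ∀ {a b c d} → Σ ℕ (ACopy a b c d) → Path
APath (_ , P , _) = P

-- weighted objects (copies) of V_n: a Dyck path of length 2n written as a
-- concatenation of paths from the A_s, with a copy chosen for each factor
-- (so a path has as many copies as the product of the factor weights)
VCopy : (a b c d n : ℕ) → Set
VCopy a b c d n =
  Σ Path λ P → length P ≡ 2 * n × T (isDyck P) ×
    Σ (List (Σ ℕ (ACopy a b c d))) λ fs → concatMap APath fs ≡ P

module Submission where

-- A path of A_s is either the pyramid u^s d^s or an elevation u^k u^{i₁}d^{i₁} ⋯ u^{i_r}d^{i_r} d^k,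
-- whose copies are counted through the composition (k; i₁, …, i_r) of s. Peeling one step off the
-- first inner pyramid (α₁ = a - b, α_{i+1} = b α_i) or off the elevation (β₁ = c, β_{k+1} = d β_k)
-- gives linear recurrences solved by [xˢ] (a - b) c x² / ((1 - a x)(1 - d x)), so the total weight
-- of A_s depends only on (a - b) c and {a, d}. Equal weights give bijections between the copies of
-- A_s, and as a copy of V_n is a list of copies of elements of the A_s, they extend factor by factor.

open import Defs
open import Data.Bool using (Bool; true; false; T; _∧_; not)
open import Data.Bool.Properties using (T-∧; T-irrelevant)
open import Data.Empty using (⊥)
open import Data.Fin using (Fin; zero)
open import Data.Fin.Properties using (+↔⊎; *↔×)
open import Data.Integer as ℤ using (ℤ; 0ℤ; 1ℤ; -1ℤ; +_)
import Data.Integer.Properties as ℤ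
open import Data.List using (List; []; _∷_; _++_; [_]; map; concatMap; replicate; length; upTo; applyUpTo)
open import Data.List.Properties using (++-assoc; ++-identityʳ; length-++; length-replicate; map-∘; map-cong; map-id)
import Data.List.Relation.Unary.All as All
open All using (All; []; _∷_)
open import Data.List.Relation.Unary.All.Properties using (all⁺; all⁻; map⁺; map⁻; ++⁺; concat⁺; concat⁻)
open import Data.Nat as ℕ using (ℕ; zero; suc; _+_; _*_; _∸_; _^_; _≤_; _≤?_; z≤n; s≤s)
import Data.Nat.Properties as ℕ
open import Data.Nat.Properties using (≤-irrelevant; ≡-irrelevant)
open import Data.Nat.ListAction using (sum; product)
open import Data.Nat.Tactic.RingSolver using (solve-∀)
open import Data.Product using (Σ; _×_; _,_; proj₁; proj₂; map₁; map₂)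
open import Data.Product.Function.NonDependent.Propositional using (_×-↔_)
open import Data.Sum using (_⊎_; inj₁; inj₂)
open import Data.Sum.Function.Propositional using (_⊎-↔_)
open import Data.Unit using (⊤; tt)
open import Function using (Equivalence; _∘_; case_of_)
open import Function.Bundles using (_↔_; Inverse; mk↔ₛ′)
open import Function.Construct.Composition using (_↔-∘_)
open import Function.Construct.Identity using (↔-id)
open import Function.Construct.Symmetry using (↔-sym)
open import Relation.Nullary.Decidable using (⌊_⌋; toWitness; fromWitness; from-yes)
open import Relation.Binary.PropositionalEquality hiding ([_])

-- Dyck and primitive paths

All-splits-++ : {A : Set} {R : List A × List A → Set} (p q : List A) →
  All (λ s → R (proj₁ s , proj₂ s ++ q)) (splits p) →
  All (λ s → R (p ++ proj₁ s , proj₂ s)) (splits q) →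
  All R (splits (p ++ q))
All-splits-++         []      q (_ ∷ []) Rq = Rq
All-splits-++ {R = R} (x ∷ p) q (r ∷ Rp) Rq =
  r ∷ map⁺ (All-splits-++ {R = λ s → R (map₁ (x ∷_) s)} p q (map⁻ Rp) Rq)

height-++ : (p q : Path) → height (p ++ q) ≡ height p ℤ.+ height q
height-++ []      q = sym (ℤ.+-identityˡ _)
height-++ (U ∷ p) q = trans (cong (λ h → 1ℤ ℤ.+ h) (height-++ p q)) (sym (ℤ.+-assoc 1ℤ (height p) (height q)))
height-++ (D ∷ p) q = trans (cong (λ h → -1ℤ ℤ.+ h) (height-++ p q)) (sym (ℤ.+-assoc -1ℤ (height p) (height q)))

height-++-balanced : (p q : Path) → height p ≡ 0ℤ → height (p ++ q) ≡ height q
height-++-balanced p q hp =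
  trans (height-++ p q) (trans (cong (ℤ._+ height q) hp) (ℤ.+-identityˡ (height q)))

NonNegative : Path → Set
NonNegative p = All (λ s → 0ℤ ℤ.≤ height (proj₁ s)) (splits p)

Dyck : Path → Set
Dyck p = NonNegative p × height p ≡ 0ℤ

isDyck⇒Dyck : (p : Path) → T (isDyck p) → Dyck p
isDyck⇒Dyck p t =
  let nonNeg , balanced = Equivalence.to T-∧ t
  in All.map toWitness (all⁺ _ (splits p) nonNeg) , toWitness balanced

Dyck⇒isDyck : (p : Path) → Dyck p → T (isDyck p)
Dyck⇒isDyck p (nonNeg , balanced) =
  Equivalence.from T-∧ (all⁻ _ (All.map fromWitness nonNeg) , fromWitness balanced)

Dyck-[] : Dyck []
Dyck-[] = ℤ.≤-refl ∷ [] , refl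

Dyck-++ : {p q : Path} → Dyck p → Dyck q → Dyck (p ++ q)
Dyck-++ {p} {q} (nonNegp , hp) (nonNegq , hq) =
  All-splits-++ p q nonNegp (All.map (λ {s} → subst (0ℤ ℤ.≤_) (sym (height-++-balanced p (proj₁ s) hp))) nonNegq) ,
  trans (height-++-balanced p q hp) hq

0≤1+ : {h : ℤ} → 0ℤ ℤ.≤ h → 0ℤ ℤ.≤ 1ℤ ℤ.+ h
0≤1+ {+ _} _ = ℤ.+≤+ z≤n

height-++-[] : (W : Path) → height (W ++ []) ≡ height W
height-++-[] W = cong height (++-identityʳ W)

height-descent : {W : Path} → Dyck W → height (W ++ [ D ]) ≡ -1ℤ
height-descent {W} (_ , hW) = height-++-balanced W [ D ] hW

height-lift : {W : Path} → Dyck W → height (U ∷ W ++ [ D ]) ≡ 0ℤ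
height-lift dW = cong (λ h → 1ℤ ℤ.+ h) (height-descent dW)

Dyck-lift : {W : Path} → Dyck W → Dyck (U ∷ W ++ [ D ])
Dyck-lift {W} dW@(nonNeg , hW) =
  ℤ.≤-refl ∷ map⁺ (All-splits-++ W [ D ] (All.map 0≤1+ nonNeg)
    (0≤1+ (ℤ.≤-reflexive (sym (trans (height-++-[] W) hW))) ∷ ℤ.≤-reflexive (sym (height-lift dW)) ∷ [])) ,
  height-lift dW

above-axis : {h : ℤ} → 0ℤ ℤ.≤ h → (x : Bool) → T (not (x ∧ ⌊ 1ℤ ℤ.+ h ℤ.≟ 0ℤ ⌋))
above-axis {+ _} _ false = tt
above-axis {+ _} _ true  = tt

isPrimitive-lift : {W : Path} → Dyck W → T (isPrimitive (U ∷ W ++ [ D ]))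
isPrimitive-lift {W} dW@(nonNeg , hW) =
  Equivalence.from T-∧ (Dyck⇒isDyck (U ∷ W ++ [ D ]) (Dyck-lift dW) , Equivalence.from T-∧ (tt , all⁻ _ noInnerReturn))
  where
  NoReturn : Path × Path → Set
  NoReturn s = T (not (nonempty (proj₁ s) ∧ nonempty (proj₂ s) ∧ ⌊ height (proj₁ s) ℤ.≟ 0ℤ ⌋))

  noInnerReturn : All NoReturn (splits (U ∷ W ++ [ D ]))
  noInnerReturn = tt ∷ map⁺ (All-splits-++ W [ D ]
    (All.map (λ {s} h → above-axis h (nonempty (proj₂ s ++ [ D ]))) nonNeg)
    (above-axis (ℤ.≤-reflexive (sym (trans (height-++-[] W) hW))) true ∷ tt ∷ []))

elevate : ℕ → Path → Path
elevate k Y = replicate k U ++ Y ++ replicate k D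

replicate-snoc : {A : Set} (j : ℕ) (x : A) → x ∷ replicate j x ≡ replicate j x ++ [ x ]
replicate-snoc zero    x = refl
replicate-snoc (suc j) x = cong (x ∷_) (replicate-snoc j x)

elevate-suc : (j : ℕ) (Y : Path) → elevate (suc j) Y ≡ U ∷ elevate j Y ++ [ D ]
elevate-suc j Y = cong (U ∷_) (begin
  replicate j U ++ Y ++ D ∷ replicate j D        ≡⟨ cong (λ z → replicate j U ++ Y ++ z) (replicate-snoc j D) ⟩
  replicate j U ++ Y ++ replicate j D ++ [ D ]   ≡⟨ cong (replicate j U ++_) (sym (++-assoc Y _ [ D ])) ⟩
  replicate j U ++ (Y ++ replicate j D) ++ [ D ] ≡⟨ sym (++-assoc (replicate j U) _ [ D ]) ⟩
  elevate j Y ++ [ D ]                           ∎)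
  where open ≡-Reasoning

Dyck-elevate : (k : ℕ) {Y : Path} → Dyck Y → Dyck (elevate k Y)
Dyck-elevate zero    {Y} dY = subst Dyck (sym (++-identityʳ Y)) dY
Dyck-elevate (suc j) {Y} dY = subst Dyck (sym (elevate-suc j Y)) (Dyck-lift (Dyck-elevate j dY))

isPrimitive-elevate : (k : ℕ) → 1 ≤ k → {Y : Path} → Dyck Y → T (isPrimitive (elevate k Y))
isPrimitive-elevate (suc j) _ {Y} dY =
  subst (T ∘ isPrimitive) (sym (elevate-suc j Y)) (isPrimitive-lift (Dyck-elevate j dY))

Dyck-pyr : (h : ℕ) → Dyck (pyr h)
Dyck-pyr h = Dyck-elevate h Dyck-[]

Dyck-concatMap : {A : Set} (f : A → Path) → (∀ x → Dyck (f x)) → (xs : List A) → Dyck (concatMap f xs)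
Dyck-concatMap f Df []       = Dyck-[]
Dyck-concatMap f Df (x ∷ xs) = Dyck-++ (Df x) (Dyck-concatMap f Df xs)

length-elevate : (k : ℕ) (Y : Path) → length (elevate k Y) ≡ k + (length Y + k)
length-elevate k Y = begin
  length (elevate k Y)                                 ≡⟨ length-++ (replicate k U) ⟩
  length (replicate k U) + length (Y ++ replicate k D) ≡⟨ cong₂ _+_ (length-replicate k) (length-++ Y) ⟩
  k + (length Y + length (replicate k D))              ≡⟨ cong (λ z → k + (length Y + z)) (length-replicate k) ⟩
  k + (length Y + k)                                   ∎
  where open ≡-Reasoning

length-pyr : (h : ℕ) → length (pyr h) ≡ 2 * h
length-pyr h = trans (length-elevate h []) (lemma h)
  where
  lemma : ∀ h → h + (0 + h) ≡ 2 * h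
  lemma = solve-∀

length-pyramids : (is : List ℕ) → length (concatMap pyr is) ≡ 2 * sum is
length-pyramids []       = refl
length-pyramids (i ∷ is) =
  trans (length-++ (pyr i)) (trans (cong₂ _+_ (length-pyr i) (length-pyramids is)) (sym (ℕ.*-distribˡ-+ 2 i (sum is))))

length-elevate-pyramids : (k : ℕ) (is : List ℕ) → length (elevate k (concatMap pyr is)) ≡ 2 * (k + sum is)
length-elevate-pyramids k is =
  trans (length-elevate k _) (trans (cong (λ n → k + (n + k)) (length-pyramids is)) (lemma k (sum is)))
  where
  lemma : ∀ k n → k + (2 * n + k) ≡ 2 * (k + n)
  lemma = solve-∀

-- Valley levels

stepHeight : Step → ℤ
stepHeight U = 1ℤ
stepHeight D = -1ℤ

ascend descend : ℕ → ℤ → ℤ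
ascend  zero    m = m
ascend  (suc i) m = 1ℤ ℤ.+ ascend i m
descend zero    m = m
descend (suc i) m = -1ℤ ℤ.+ descend i m

ascend-≡ : (i : ℕ) (m : ℤ) → ascend i m ≡ + i ℤ.+ m
ascend-≡ zero    m = sym (ℤ.+-identityˡ m)
ascend-≡ (suc i) m = trans (cong (λ h → 1ℤ ℤ.+ h) (ascend-≡ i m)) (sym (ℤ.+-assoc 1ℤ (+ i) m))

descend-≡ : (i : ℕ) (m : ℤ) → descend i m ≡ ℤ.- + i ℤ.+ m
descend-≡ zero    m = sym (ℤ.+-identityˡ m)
descend-≡ (suc i) m = begin
  -1ℤ ℤ.+ descend i m          ≡⟨ cong (λ h → -1ℤ ℤ.+ h) (descend-≡ i m) ⟩
  -1ℤ ℤ.+ (ℤ.- + i ℤ.+ m)      ≡⟨ sym (ℤ.+-assoc -1ℤ (ℤ.- + i) m) ⟩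
  (-1ℤ ℤ.+ ℤ.- + i) ℤ.+ m      ≡⟨ cong (ℤ._+ m) (-1-neg i) ⟩
  ℤ.- + suc i ℤ.+ m            ∎
  where
  open ≡-Reasoning
  -1-neg : (i : ℕ) → -1ℤ ℤ.+ ℤ.- + i ≡ ℤ.- + suc i
  -1-neg zero    = refl
  -1-neg (suc i) = refl

ascend-descend : (i : ℕ) (m : ℤ) → ascend i (descend i m) ≡ m
ascend-descend i m = begin
  ascend i (descend i m)      ≡⟨ ascend-≡ i _ ⟩
  + i ℤ.+ descend i m         ≡⟨ cong (λ h → + i ℤ.+ h) (descend-≡ i m) ⟩
  + i ℤ.+ (ℤ.- + i ℤ.+ m)     ≡⟨ sym (ℤ.+-assoc (+ i) (ℤ.- + i) m) ⟩
  (+ i ℤ.+ ℤ.- + i) ℤ.+ m     ≡⟨ cong (ℤ._+ m) (ℤ.+-inverseʳ (+ i)) ⟩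
  0ℤ ℤ.+ m                    ≡⟨ ℤ.+-identityˡ m ⟩
  m                           ∎
  where open ≡-Reasoning

All-valleyAt-∷ : (P : ℤ → Set) (x : Step) (xs ys : Path) →
  All (λ m → P (stepHeight x ℤ.+ m)) (valleyAt (xs , ys)) → All P (valleyAt (x ∷ xs , ys))
All-valleyAt-∷ P x xs []           _        = []
All-valleyAt-∷ P x xs (U ∷ ys)     _        = []
All-valleyAt-∷ P x xs (D ∷ [])     _        = []
All-valleyAt-∷ P x xs (D ∷ D ∷ ys) _        = []
All-valleyAt-∷ P U xs (D ∷ U ∷ ys) (p ∷ []) = p ∷ []
All-valleyAt-∷ P D xs (D ∷ U ∷ ys) (p ∷ []) = p ∷ []

All-valleyLevels-∷ : (P : ℤ → Set) (x : Step) (xs : Path) → All P (valleyAt ([] , x ∷ xs)) →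
  All (λ m → P (stepHeight x ℤ.+ m)) (valleyLevels xs) → All P (valleyLevels (x ∷ xs))
All-valleyLevels-∷ P x xs first rest = ++⁺ first (concat⁺ (map⁺ {f = valleyAt} (map⁺ {f = map₁ (x ∷_)}
  (All.map (λ {s} → All-valleyAt-∷ P x (proj₁ s) (proj₂ s))
    (map⁻ (concat⁻ {xss = map valleyAt (splits xs)} rest))))))

All-valleyLevels-ascent : (P : ℤ → Set) (i : ℕ) (t : Path) →
  All (P ∘ ascend i) (valleyLevels t) → All P (valleyLevels (replicate i U ++ t))
All-valleyLevels-ascent P zero    t h = h
All-valleyLevels-ascent P (suc i) t h =
  All-valleyLevels-∷ P U (replicate i U ++ t) [] (All-valleyLevels-ascent (λ m → P (1ℤ ℤ.+ m)) i t h)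

StartsUp : Path → Set
StartsUp (U ∷ _) = ⊤
StartsUp _       = ⊥

-- The only new valley is at the foot of the descent, when t starts with U.
All-valleyLevels-descent : (P : ℤ → Set) (j : ℕ) (t : Path) → (StartsUp t → P (descend (suc j) 0ℤ)) →
  All (P ∘ descend (suc j)) (valleyLevels t) → All P (valleyLevels (D ∷ replicate j D ++ t))
All-valleyLevels-descent P zero    []      _    h = All-valleyLevels-∷ P D [] [] h
All-valleyLevels-descent P zero    (U ∷ t) foot h = All-valleyLevels-∷ P D (U ∷ t) (foot tt ∷ []) h
All-valleyLevels-descent P zero    (D ∷ t) _    h = All-valleyLevels-∷ P D (D ∷ t) [] h
All-valleyLevels-descent P (suc j) t       foot h =
  All-valleyLevels-∷ P D (D ∷ replicate j D ++ t) [] (All-valleyLevels-descent (λ m → P (-1ℤ ℤ.+ m)) j t foot h)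

All-valleyLevels-descents : (P : ℤ → Set) (k : ℕ) → All P (valleyLevels (replicate k D))
All-valleyLevels-descents P zero    = []
All-valleyLevels-descents P (suc k) =
  subst (λ p → All P (valleyLevels (D ∷ p))) (++-identityʳ (replicate k D))
    (All-valleyLevels-descent P k [] (λ ()) [])

All-valleyLevels-pyr-++ : (P : ℤ → Set) (h : ℕ) (t : Path) → P 0ℤ → All P (valleyLevels t) →
  All P (valleyLevels (pyr h ++ t))
All-valleyLevels-pyr-++ P zero    t _  Pt = Pt
All-valleyLevels-pyr-++ P (suc j) t P0 Pt =
  subst (All P ∘ valleyLevels) (sym (++-assoc (replicate (suc j) U) (replicate (suc j) D) t))
    (All-valleyLevels-ascent P (suc j) (replicate (suc j) D ++ t)
      (All-valleyLevels-descent (P ∘ ascend (suc j)) j t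
        (λ _ → subst P (sym (ascend-descend (suc j) 0ℤ)) P0)
        (All.map (λ {m} → subst P (sym (ascend-descend (suc j) m))) Pt)))

All-valleyLevels-pyramids-++ : (P : ℤ → Set) (is : List ℕ) (t : Path) → P 0ℤ → All P (valleyLevels t) →
  All P (valleyLevels (concatMap pyr is ++ t))
All-valleyLevels-pyramids-++ P []       t _  Pt = Pt
All-valleyLevels-pyramids-++ P (i ∷ is) t P0 Pt =
  subst (All P ∘ valleyLevels) (sym (++-assoc (pyr i) (concatMap pyr is) t))
    (All-valleyLevels-pyr-++ P i (concatMap pyr is ++ t) P0 (All-valleyLevels-pyramids-++ P is t P0 Pt))

allSame-constant : (v : ℤ) (ls : List ℤ) → All (_≡ v) ls → T (allSame ls)
allSame-constant v []       _           = tt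
allSame-constant v (l ∷ ls) (l≡v ∷ ls≡v) =
  all⁻ _ (All.map (λ m≡v → fromWitness (trans m≡v (sym l≡v))) ls≡v)

sameLevelValleys-elevate-pyramids : (k : ℕ) (is : List ℕ) → T (sameLevelValleys (elevate k (concatMap pyr is)))
sameLevelValleys-elevate-pyramids k is = allSame-constant (+ k) _
  (All-valleyLevels-ascent (_≡ + k) k (concatMap pyr is ++ replicate k D)
    (All-valleyLevels-pyramids-++ (λ m → ascend k m ≡ + k) is (replicate k D)
      (trans (ascend-≡ k 0ℤ) (ℤ.+-identityʳ (+ k))) (All-valleyLevels-descents _ k)))

sameLevelValleys-pyr : (h : ℕ) → T (sameLevelValleys (pyr h))
sameLevelValleys-pyr h = allSame-constant 0ℤ _
  (All-valleyLevels-ascent (_≡ 0ℤ) h (replicate h D) (All-valleyLevels-descents _ h))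

-- Counting with Fin

Fin-cong : {m n : ℕ} → m ≡ n → Fin m ↔ Fin n
Fin-cong refl = ↔-id _

Fin-⊎ : {m n : ℕ} → (Fin m ⊎ Fin n) ↔ Fin (m + n)
Fin-⊎ {m} = ↔-sym (+↔⊎ {m})

Fin-× : {m n : ℕ} → (Fin m × Fin n) ↔ Fin (m * n)
Fin-× {m} = ↔-sym (*↔× {m})

Fin-split : {k m n : ℕ} → k ≡ m * n → Fin k ↔ (Fin m × Fin n)
Fin-split k≡m*n = ↔-sym Fin-× ↔-∘ Fin-cong k≡m*n

↔-Fin-linear : {A B C : Set} {p q m n : ℕ} → A ↔ ((Fin p × B) ⊎ (Fin q × C)) →
  B ↔ Fin m → C ↔ Fin n → A ↔ Fin (p * m + q * n)
↔-Fin-linear A↔ B↔ C↔ =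
  Fin-⊎ ↔-∘ (((Fin-× ↔-∘ (↔-id _ ×-↔ B↔)) ⊎-↔ (Fin-× ↔-∘ (↔-id _ ×-↔ C↔))) ↔-∘ A↔)

↔Fin0 : {A : Set} → (A → Fin 0) → A ↔ Fin 0
↔Fin0 empty = mk↔ₛ′ empty (λ ()) (λ ()) (λ x → case empty x of λ ())

δ₀ : ℕ → ℕ
δ₀ zero    = 1
δ₀ (suc _) = 0

≡0↔Fin-δ₀ : (m : ℕ) → (m ≡ 0) ↔ Fin (δ₀ m)
≡0↔Fin-δ₀ zero    = mk↔ₛ′ (λ _ → zero) (λ _ → refl) (λ { zero → refl }) (λ { refl → refl })
≡0↔Fin-δ₀ (suc m) = ↔Fin0 (λ ())

-- Weighted counts of A_s

-- h_m(x, y) = Σ_{i+j=m} xⁱ yʲ, the complete homogeneous symmetric polynomial.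
complete : ℕ → ℕ → ℕ → ℕ
complete x y zero    = 1
complete x y (suc m) = y ^ suc m + x * complete x y m

complete-suc′ : (x y m : ℕ) → complete x y (suc m) ≡ x ^ suc m + y * complete x y m
complete-suc′ x y zero    = lemma x y
  where
  lemma : ∀ x y → y * 1 + x * 1 ≡ x * 1 + y * 1
  lemma = solve-∀
complete-suc′ x y (suc m) = trans (cong (λ n → y ^ suc (suc m) + x * n) (complete-suc′ x y m))
  (lemma x y (x ^ m) (y ^ m) (complete x y m))
  where
  lemma : ∀ x y xᵐ yᵐ h → y * (y * yᵐ) + x * (x * xᵐ + y * h) ≡ x * (x * xᵐ) + y * (y * yᵐ + x * h)
  lemma = solve-∀

complete-comm : (x y m : ℕ) → complete x y m ≡ complete y x m
complete-comm x y zero    = refl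
complete-comm x y (suc m) = trans (complete-suc′ x y m) (cong (λ n → x ^ suc m + y * n) (complete-comm x y m))

sum-shift : (x y m n : ℕ) (f : ℕ → ℕ) →
  sum (map (λ i → x ^ i * y ^ (suc m ∸ i)) (applyUpTo (suc ∘ f) n)) ≡
  x * sum (map (λ i → x ^ i * y ^ (m ∸ i)) (applyUpTo f n))
sum-shift x y m zero    f = sym (ℕ.*-zeroʳ x)
sum-shift x y m (suc n) f =
  trans (cong (λ r → x * x ^ f 0 * y ^ (m ∸ f 0) + r) (sum-shift x y m n (f ∘ suc))) (lemma x (x ^ f 0) (y ^ (m ∸ f 0)) _)
  where
  lemma : ∀ x u v r → x * u * v + x * r ≡ x * (u * v + r)
  lemma = solve-∀

sum-complete : (x y m : ℕ) → sum (map (λ i → x ^ i * y ^ (m ∸ i)) (upTo (suc m))) ≡ complete x y m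
sum-complete x y zero    = refl
sum-complete x y (suc m) = begin
  1 * y ^ suc m + sum (map (λ i → x ^ i * y ^ (suc m ∸ i)) (applyUpTo suc (suc m)))
    ≡⟨ cong₂ _+_ (ℕ.*-identityˡ (y ^ suc m)) (sum-shift x y m (suc m) (λ i → i)) ⟩
  y ^ suc m + x * sum (map (λ i → x ^ i * y ^ (m ∸ i)) (upTo (suc m)))
    ≡⟨ cong (λ n → y ^ suc m + x * n) (sum-complete x y m) ⟩
  complete x y (suc m) ∎
  where open ≡-Reasoning

module Counting (a b c d : ℕ) where

  e : ℕ
  e = a ∸ b

  weight : List ℕ → ℕ
  weight is = product (map (α a b c d) is)

  weight-1∷ : (is : List ℕ) → weight (1 ∷ is) ≡ e * weight is
  weight-1∷ is = cong (_* weight is) (ℕ.*-identityʳ e)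

  weight-2+∷ : (i : ℕ) (is : List ℕ) → weight (suc (suc i) ∷ is) ≡ b * weight (suc i ∷ is)
  weight-2+∷ i is = lemma e b (b ^ i) (weight is)
    where
    lemma : ∀ e b x w → e * (b * x) * w ≡ b * (e * x * w)
    lemma = solve-∀

  IsComposition : ℕ → ℕ → List ℕ → Set
  IsComposition r m is = All (1 ≤_) is × r ≤ length is × sum is ≡ m

  Compositions : ℕ → ℕ → Set
  Compositions r m = Σ (List ℕ) λ is → IsComposition r m is × Fin (weight is)

  Compositions-≡ : ∀ {r m is} {p q : IsComposition r m is} {f g : Fin (weight is)} →
    f ≡ g → _≡_ {A = Compositions r m} (is , p , f) (is , q , g)
  Compositions-≡ {p = pos₁ , len₁ , sum₁} {pos₂ , len₂ , sum₂} refl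
    rewrite All.irrelevant ≤-irrelevant pos₁ pos₂ | ≤-irrelevant len₁ len₂ | ≡-irrelevant sum₁ sum₂ = refl

  -- The first part is either 1 (weight α₁ = a - b) or the successor of a part (extra weight b).
  Compositions-suc : ∀ {r m} → Compositions (suc r) (suc m) ↔ ((Fin e × Compositions r m) ⊎ (Fin b × Compositions (suc r) m))
  Compositions-suc = mk↔ₛ′ peel unpeel peel∘unpeel unpeel∘peel
    where
    split₁ : ∀ is → Fin (weight (1 ∷ is)) ↔ (Fin e × Fin (weight is))
    split₁ is = Fin-split (weight-1∷ is)

    split₂ : ∀ i is → Fin (weight (suc (suc i) ∷ is)) ↔ (Fin b × Fin (weight (suc i ∷ is)))
    split₂ i is = Fin-split (weight-2+∷ i is)

    peel : ∀ {r m} → Compositions (suc r) (suc m) → (Fin e × Compositions r m) ⊎ (Fin b × Compositions (suc r) m)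
    peel ([] , (_ , () , _) , _)
    peel (zero ∷ is , (() ∷ _ , _) , _)
    peel (1 ∷ is , (_ ∷ pos , s≤s len , sum) , f) =
      let u , f′ = Inverse.to (split₁ is) f in inj₁ (u , is , (pos , len , ℕ.suc-injective sum) , f′)
    peel (suc (suc i) ∷ is , (_ ∷ pos , len , sum) , f) =
      let u , f′ = Inverse.to (split₂ i is) f in
      inj₂ (u , suc i ∷ is , (s≤s z≤n ∷ pos , len , ℕ.suc-injective sum) , f′)

    unpeel : ∀ {r m} → (Fin e × Compositions r m) ⊎ (Fin b × Compositions (suc r) m) → Compositions (suc r) (suc m)
    unpeel (inj₁ (u , is , (pos , len , sum) , f)) =
      1 ∷ is , (s≤s z≤n ∷ pos , s≤s len , cong suc sum) , Inverse.from (split₁ is) (u , f)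
    unpeel (inj₂ (u , [] , (_ , () , _) , _))
    unpeel (inj₂ (u , zero ∷ is , (() ∷ _ , _) , _))
    unpeel (inj₂ (u , suc i ∷ is , (_ ∷ pos , len , sum) , f)) =
      suc (suc i) ∷ is , (s≤s z≤n ∷ pos , len , cong suc sum) , Inverse.from (split₂ i is) (u , f)

    peel∘unpeel : ∀ {r m} (y : (Fin e × Compositions r m) ⊎ (Fin b × Compositions (suc r) m)) → peel (unpeel y) ≡ y
    peel∘unpeel (inj₁ (u , is , _ , f)) =
      let eq = Inverse.strictlyInverseˡ (split₁ is) (u , f) in
      cong inj₁ (cong₂ _,_ (cong proj₁ eq) (Compositions-≡ (cong proj₂ eq)))
    peel∘unpeel (inj₂ (u , [] , (_ , () , _) , _))
    peel∘unpeel (inj₂ (u , zero ∷ is , (() ∷ _ , _) , _))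
    peel∘unpeel (inj₂ (u , suc i ∷ is , (_ ∷ _ , _) , f)) =
      let eq = Inverse.strictlyInverseˡ (split₂ i is) (u , f) in
      cong inj₂ (cong₂ _,_ (cong proj₁ eq) (Compositions-≡ (cong proj₂ eq)))

    unpeel∘peel : ∀ {r m} (x : Compositions (suc r) (suc m)) → unpeel (peel x) ≡ x
    unpeel∘peel ([] , (_ , () , _) , _)
    unpeel∘peel (zero ∷ is , (() ∷ _ , _) , _)
    unpeel∘peel (1 ∷ is , (_ ∷ _ , s≤s _ , _) , f) = Compositions-≡ (Inverse.strictlyInverseʳ (split₁ is) f)
    unpeel∘peel (suc (suc i) ∷ is , (_ ∷ _ , _ , _) , f) = Compositions-≡ (Inverse.strictlyInverseʳ (split₂ i is) f)

  Compositions-0-split : ∀ {m} → Compositions 0 m ↔ ((m ≡ 0) ⊎ Compositions 1 m)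
  Compositions-0-split = mk↔ₛ′ to from to∘from from∘to
    where
    to : ∀ {m} → Compositions 0 m → (m ≡ 0) ⊎ Compositions 1 m
    to ([]     , (_   , _ , sum) , _) = inj₁ (sym sum)
    to (i ∷ is , (pos , _ , sum) , f) = inj₂ (i ∷ is , (pos , s≤s z≤n , sum) , f)

    from : ∀ {m} → (m ≡ 0) ⊎ Compositions 1 m → Compositions 0 m
    from (inj₁ m≡0)                      = [] , ([] , z≤n , sym m≡0) , zero
    from (inj₂ (is , (pos , _ , sum) , f)) = is , (pos , z≤n , sum) , f

    to∘from : ∀ {m} (y : (m ≡ 0) ⊎ Compositions 1 m) → to (from y) ≡ y
    to∘from (inj₁ refl)                  = refl
    to∘from (inj₂ ([] , (_ , () , _) , _))
    to∘from (inj₂ (_ ∷ _ , _ , _))       = cong inj₂ (Compositions-≡ refl)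

    from∘to : ∀ {m} (x : Compositions 0 m) → from (to x) ≡ x
    from∘to ([] , ([] , _ , _) , zero) = Compositions-≡ refl
    from∘to (_ ∷ _ , _ , _)            = Compositions-≡ refl

  Compositions-of-0 : ∀ {r} → Compositions (suc r) 0 ↔ Fin 0
  Compositions-of-0 = ↔Fin0 λ
    { ([] , (_ , () , _) , _)
    ; (zero ∷ _ , (() ∷ _ , _) , _)
    ; (suc _ ∷ _ , (_ , _ , ()) , _) }

  #compositions≥1 : ℕ → ℕ
  #compositions≥1 zero    = 0
  #compositions≥1 (suc m) = e * (δ₀ m + #compositions≥1 m) + b * #compositions≥1 m

  #compositions≥2 : ℕ → ℕ
  #compositions≥2 zero    = 0
  #compositions≥2 (suc m) = e * #compositions≥1 m + b * #compositions≥2 m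

  Compositions≥1↔Fin : (m : ℕ) → Compositions 1 m ↔ Fin (#compositions≥1 m)
  Compositions≥1↔Fin zero    = Compositions-of-0
  Compositions≥1↔Fin (suc m) = ↔-Fin-linear Compositions-suc
    (Fin-⊎ ↔-∘ ((≡0↔Fin-δ₀ m ⊎-↔ Compositions≥1↔Fin m) ↔-∘ Compositions-0-split)) (Compositions≥1↔Fin m)

  Compositions≥2↔Fin : (m : ℕ) → Compositions 2 m ↔ Fin (#compositions≥2 m)
  Compositions≥2↔Fin zero    = Compositions-of-0
  Compositions≥2↔Fin (suc m) = ↔-Fin-linear Compositions-suc (Compositions≥1↔Fin m) (Compositions≥2↔Fin m)

  IsElevation : ℕ → ℕ → List ℕ → Set
  IsElevation s k is = 1 ≤ k × 2 ≤ length is × All (1 ≤_) is × k + sum is ≡ s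

  -- Copies of the paths u^k u^{i₁}d^{i₁} ⋯ u^{i_r}d^{i_r} d^k of A_s, recorded by k and i₁ … i_r.
  Elevations : ℕ → Set
  Elevations s = Σ ℕ λ k → Σ (List ℕ) λ is → IsElevation s k is × Fin (β a b c d k * weight is)

  Elevations-≡ : ∀ {s k is} {p q : IsElevation s k is} {f g : Fin (β a b c d k * weight is)} →
    f ≡ g → _≡_ {A = Elevations s} (k , is , p , f) (k , is , q , g)
  Elevations-≡ {p = k≥1 , len₁ , pos₁ , sum₁} {k≥1′ , len₂ , pos₂ , sum₂} refl
    rewrite ≤-irrelevant k≥1 k≥1′ | ≤-irrelevant len₁ len₂ | All.irrelevant ≤-irrelevant pos₁ pos₂
          | ≡-irrelevant sum₁ sum₂ = refl

  -- As for compositions, with β₁ = c and β_{k+2} = d β_{k+1}.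
  Elevations-suc : ∀ {s} → Elevations (suc s) ↔ ((Fin c × Compositions 2 s) ⊎ (Fin d × Elevations s))
  Elevations-suc = mk↔ₛ′ peel unpeel peel∘unpeel unpeel∘peel
    where
    split₁ : ∀ is → Fin (β a b c d 1 * weight is) ↔ (Fin c × Fin (weight is))
    split₁ is = Fin-split (cong (_* weight is) (ℕ.*-identityʳ c))

    split₂ : ∀ k is → Fin (β a b c d (suc (suc k)) * weight is) ↔ (Fin d × Fin (β a b c d (suc k) * weight is))
    split₂ k is = Fin-split (lemma c d (d ^ k) (weight is))
      where
      lemma : ∀ c d x w → c * (d * x) * w ≡ d * (c * x * w)
      lemma = solve-∀

    peel : ∀ {s} → Elevations (suc s) → (Fin c × Compositions 2 s) ⊎ (Fin d × Elevations s)
    peel (zero , _ , (() , _) , _)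
    peel (1 , is , (_ , len , pos , sum) , f) =
      let u , f′ = Inverse.to (split₁ is) f in inj₁ (u , is , (pos , len , ℕ.suc-injective sum) , f′)
    peel (suc (suc k) , is , (_ , len , pos , sum) , f) =
      let u , f′ = Inverse.to (split₂ k is) f in
      inj₂ (u , suc k , is , (s≤s z≤n , len , pos , ℕ.suc-injective sum) , f′)

    unpeel : ∀ {s} → (Fin c × Compositions 2 s) ⊎ (Fin d × Elevations s) → Elevations (suc s)
    unpeel (inj₁ (u , is , (pos , len , sum) , f)) =
      1 , is , (s≤s z≤n , len , pos , cong suc sum) , Inverse.from (split₁ is) (u , f)
    unpeel (inj₂ (u , zero , _ , (() , _) , _))
    unpeel (inj₂ (u , suc k , is , (_ , len , pos , sum) , f)) =
      suc (suc k) , is , (s≤s z≤n , len , pos , cong suc sum) , Inverse.from (split₂ k is) (u , f)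

    peel∘unpeel : ∀ {s} (y : (Fin c × Compositions 2 s) ⊎ (Fin d × Elevations s)) → peel (unpeel y) ≡ y
    peel∘unpeel (inj₁ (u , is , _ , f)) =
      let eq = Inverse.strictlyInverseˡ (split₁ is) (u , f) in
      cong inj₁ (cong₂ _,_ (cong proj₁ eq) (Compositions-≡ (cong proj₂ eq)))
    peel∘unpeel (inj₂ (u , zero , _ , (() , _) , _))
    peel∘unpeel (inj₂ (u , suc k , is , _ , f)) =
      let eq = Inverse.strictlyInverseˡ (split₂ k is) (u , f) in
      cong inj₂ (cong₂ _,_ (cong proj₁ eq) (Elevations-≡ (cong proj₂ eq)))

    unpeel∘peel : ∀ {s} (x : Elevations (suc s)) → unpeel (peel x) ≡ x
    unpeel∘peel (zero , _ , (() , _) , _)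
    unpeel∘peel (1 , is , _ , f)           = Elevations-≡ (Inverse.strictlyInverseʳ (split₁ is) f)
    unpeel∘peel (suc (suc k) , is , _ , f) = Elevations-≡ (Inverse.strictlyInverseʳ (split₂ k is) f)

  #elevations : ℕ → ℕ
  #elevations zero    = 0
  #elevations (suc s) = c * #compositions≥2 s + d * #elevations s

  Elevations↔Fin : (s : ℕ) → Elevations s ↔ Fin (#elevations s)
  Elevations↔Fin zero    = ↔Fin0 λ { (zero , _ , (() , _) , _) ; (suc _ , _ , (_ , _ , _ , ()) , _) }
  Elevations↔Fin (suc s) = ↔-Fin-linear Elevations-suc (Compositions≥2↔Fin s) (Elevations↔Fin s)

  ACopy-≡ : ∀ {s P} {len₁ len₂ : length P ≡ 2 * s} {prim₁ prim₂ : T (isPrimitive P)}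
    {same₁ same₂ : T (sameLevelValleys P)} {copy : Σ ℕ λ w → Weighted a b c d P w × Fin w} →
    _≡_ {A = ACopy a b c d s} (P , len₁ , prim₁ , same₁ , copy) (P , len₂ , prim₂ , same₂ , copy)
  ACopy-≡ {len₁ = len₁} {len₂} {prim₁} {prim₂} {same₁} {same₂}
    rewrite ≡-irrelevant len₁ len₂ | T-irrelevant prim₁ prim₂ | T-irrelevant same₁ same₂ = refl

  -- The remaining components of a copy (length, primitivity, valley levels) are
  -- propositions determined by the pyramid or the elevation.
  ACopy↔pyramid⊎Elevations : (s : ℕ) → ACopy a b c d s ↔ (Fin (γ a b c d s) ⊎ Elevations s)
  ACopy↔pyramid⊎Elevations s = mk↔ₛ′ to (from s) (to∘from s) (from∘to s)
    where
    to : ∀ {s} → ACopy a b c d s → Fin (γ a b c d s) ⊎ Elevations s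
    to {s} (_ , len , _ , _ , _ , pyramidW n , f) =
      inj₁ (subst (Fin ∘ γ a b c d) (ℕ.*-cancelˡ-≡ n s 2 (trans (sym (length-pyr n)) len)) f)
    to {s} (_ , len , _ , _ , _ , generalW k is k≥1 two≤ pos , f) =
      inj₂ (k , is , (k≥1 , two≤ , pos , ℕ.*-cancelˡ-≡ (k + sum is) s 2 (trans (sym (length-elevate-pyramids k is)) len)) , f)

    from : ∀ s → Fin (γ a b c d s) ⊎ Elevations s → ACopy a b c d s
    from s (inj₂ (k , is , (k≥1 , two≤ , pos , sum) , f)) =
      elevate k (concatMap pyr is) , trans (length-elevate-pyramids k is) (cong (2 *_) sum) ,
      isPrimitive-elevate k k≥1 (Dyck-concatMap pyr Dyck-pyr is) , sameLevelValleys-elevate-pyramids k is ,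
      _ , generalW k is k≥1 two≤ pos , f
    from zero    (inj₁ ())
    from (suc n) (inj₁ f) =
      pyr (suc n) , length-pyr (suc n) , isPrimitive-elevate (suc n) (s≤s z≤n) {[]} Dyck-[] ,
      sameLevelValleys-pyr (suc n) , _ , pyramidW (suc n) , f

    to∘from : ∀ s (y : Fin (γ a b c d s) ⊎ Elevations s) → to (from s y) ≡ y
    to∘from s       (inj₂ _) = cong inj₂ (Elevations-≡ refl)
    to∘from zero    (inj₁ ())
    to∘from (suc n) (inj₁ f) = cong (λ (eq : suc n ≡ suc n) → inj₁ (subst (Fin ∘ γ a b c d) eq f)) (≡-irrelevant _ refl)

    from-pyramid : ∀ n s (n≡s : n ≡ s) (len : length (pyr n) ≡ 2 * s) (prim : T (isPrimitive (pyr n)))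
      (same : T (sameLevelValleys (pyr n))) (f : Fin (γ a b c d n)) →
      from s (inj₁ (subst (Fin ∘ γ a b c d) n≡s f)) ≡ (pyr n , len , prim , same , γ a b c d n , pyramidW n , f)
    from-pyramid zero    _ refl _ _ _ ()
    from-pyramid (suc n) _ refl _ _ _ _ = ACopy-≡ {s = suc n}

    from∘to : ∀ s (x : ACopy a b c d s) → from s (to x) ≡ x
    from∘to s (_ , len , prim , same , _ , pyramidW n , f) = from-pyramid n s _ len prim same f
    from∘to s (_ , _ , _ , _ , _ , generalW _ _ _ _ _ , _) = ACopy-≡ {s = s}

  #A : ℕ → ℕ
  #A s = γ a b c d s + #elevations s

  ACopy↔Fin : (s : ℕ) → ACopy a b c d s ↔ Fin (#A s)
  ACopy↔Fin s = Fin-⊎ ↔-∘ ((↔-id _ ⊎-↔ Elevations↔Fin s) ↔-∘ ACopy↔pyramid⊎Elevations s)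

  #A-1 : #A 1 ≡ 0
  #A-1 = cong₂ _+_ (ℕ.*-zeroʳ c) (ℕ.*-zeroʳ d)

  γ-closed : (m : ℕ) → γ a b c d (2 + m) ≡ e * c * complete b d m
  γ-closed m = cong (e * c *_) (sum-complete b d m)

  γ-step : (m : ℕ) → γ a b c d (3 + m) ≡ e * c * b ^ suc m + d * γ a b c d (2 + m)
  γ-step m = begin
    γ a b c d (3 + m)                                ≡⟨ γ-closed (suc m) ⟩
    e * c * complete b d (suc m)                     ≡⟨ cong (e * c *_) (complete-suc′ b d m) ⟩
    e * c * (b ^ suc m + d * complete b d m)         ≡⟨ lemma (e * c) (b ^ suc m) d (complete b d m) ⟩
    e * c * b ^ suc m + d * (e * c * complete b d m) ≡⟨ cong (λ z → e * c * b ^ suc m + d * z) (sym (γ-closed m)) ⟩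
    e * c * b ^ suc m + d * γ a b c d (2 + m)        ∎
    where
    open ≡-Reasoning
    lemma : ∀ k x y z → k * (x + y * z) ≡ k * x + y * (k * z)
    lemma = solve-∀

  module _ (a≡e+b : a ≡ e + b) where

    #compositions≥1-closed : (m : ℕ) → #compositions≥1 (suc m) ≡ e * a ^ m
    #compositions≥1-closed zero    = lemma e b
      where
      lemma : ∀ e b → e * (1 + 0) + b * 0 ≡ e * 1
      lemma = solve-∀
    #compositions≥1-closed (suc m) = begin
      e * (0 + #compositions≥1 (suc m)) + b * #compositions≥1 (suc m)
        ≡⟨ cong (λ n → e * (0 + n) + b * n) (#compositions≥1-closed m) ⟩
      e * (0 + e * a ^ m) + b * (e * a ^ m)   ≡⟨ lemma e b (a ^ m) ⟩
      e * ((e + b) * a ^ m)                   ≡⟨ cong (λ x → e * (x * a ^ m)) (sym a≡e+b) ⟩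
      e * a ^ suc m                           ∎
      where
      open ≡-Reasoning
      lemma : ∀ e b x → e * (0 + e * x) + b * (e * x) ≡ e * ((e + b) * x)
      lemma = solve-∀

    -- Compositions with at least one part, less the one-part composition (weight e bᵐ).
    #compositions≥2-closed : (m : ℕ) → e * b ^ m + #compositions≥2 (suc m) ≡ e * a ^ m
    #compositions≥2-closed zero    = lemma e b
      where
      lemma : ∀ e b → e * 1 + (e * 0 + b * 0) ≡ e * 1
      lemma = solve-∀
    #compositions≥2-closed (suc m) = begin
      e * b ^ suc m + (e * #compositions≥1 (suc m) + b * #compositions≥2 (suc m))
        ≡⟨ cong (λ n → e * b ^ suc m + (e * n + b * #compositions≥2 (suc m))) (#compositions≥1-closed m) ⟩
      e * b ^ suc m + (e * (e * a ^ m) + b * #compositions≥2 (suc m))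
        ≡⟨ lemma₁ e b (a ^ m) (b ^ m) (#compositions≥2 (suc m)) ⟩
      e * (e * a ^ m) + b * (e * b ^ m + #compositions≥2 (suc m))
        ≡⟨ cong (λ n → e * (e * a ^ m) + b * n) (#compositions≥2-closed m) ⟩
      e * (e * a ^ m) + b * (e * a ^ m)       ≡⟨ lemma₂ e b (a ^ m) ⟩
      e * ((e + b) * a ^ m)                   ≡⟨ cong (λ x → e * (x * a ^ m)) (sym a≡e+b) ⟩
      e * a ^ suc m                           ∎
      where
      open ≡-Reasoning
      lemma₁ : ∀ e b x y z → e * (b * y) + (e * (e * x) + b * z) ≡ e * (e * x) + b * (e * y + z)
      lemma₁ = solve-∀
      lemma₂ : ∀ e b x → e * (e * x) + b * (e * x) ≡ e * ((e + b) * x)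
      lemma₂ = solve-∀

    #A-closed : (m : ℕ) → #A (2 + m) ≡ e * c * complete d a m
    #A-closed zero    = lemma e b c d
      where
      lemma : ∀ e b c d → e * c * (1 * 1 + 0) + (c * (e * 0 + b * 0) + d * (c * 0 + d * 0)) ≡ e * c * 1
      lemma = solve-∀
    #A-closed (suc m) = begin
      γ a b c d (3 + m) + (c * #compositions≥2 (2 + m) + d * #elevations (2 + m))
        ≡⟨ cong (_+ (c * #compositions≥2 (2 + m) + d * #elevations (2 + m))) (γ-step m) ⟩
      e * c * b ^ suc m + d * γ a b c d (2 + m) + (c * #compositions≥2 (2 + m) + d * #elevations (2 + m))
        ≡⟨ lemma₁ e c (b ^ suc m) d (γ a b c d (2 + m)) (#compositions≥2 (2 + m)) (#elevations (2 + m)) ⟩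
      c * (e * b ^ suc m + #compositions≥2 (2 + m)) + d * #A (2 + m)
        ≡⟨ cong₂ (λ x y → c * x + d * y) (#compositions≥2-closed (suc m)) (#A-closed m) ⟩
      c * (e * a ^ suc m) + d * (e * c * complete d a m)
        ≡⟨ lemma₂ e c (a ^ suc m) d (complete d a m) ⟩
      e * c * complete d a (suc m)            ∎
      where
      open ≡-Reasoning
      lemma₁ : ∀ e c x d y z w → e * c * x + d * y + (c * z + d * w) ≡ c * (e * x + z) + d * (y + w)
      lemma₁ = solve-∀
      lemma₂ : ∀ e c x d y → c * (e * x) + d * (e * c * y) ≡ e * c * (x + d * y)
      lemma₂ = solve-∀

complete-unordered : {x y x′ y′ : ℕ} → (x ≡ x′ × y ≡ y′) ⊎ (x ≡ y′ × y ≡ x′) →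
  (m : ℕ) → complete x y m ≡ complete x′ y′ m
complete-unordered (inj₁ (refl , refl)) m = refl
complete-unordered (inj₂ (refl , refl)) m = complete-comm _ _ m

-- The generating function of A is (a - b) c x² / ((1 - a x)(1 - d x)).
#A-determined : {a b c d a′ b′ c′ d′ : ℕ} → b ≤ a → b′ ≤ a′ → (a ∸ b) * c ≡ (a′ ∸ b′) * c′ →
  (d ≡ d′ × a ≡ a′) ⊎ (d ≡ a′ × a ≡ d′) → (s : ℕ) → Counting.#A a b c d s ≡ Counting.#A a′ b′ c′ d′ s
#A-determined _ _ _ _ zero = refl
#A-determined {a} {b} {c} {d} {a′} {b′} {c′} {d′} _ _ _ _ (suc zero) =
  trans (Counting.#A-1 a b c d) (sym (Counting.#A-1 a′ b′ c′ d′))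
#A-determined {a} {b} {c} {d} {a′} {b′} {c′} {d′} b≤a b′≤a′ ec≡e′c′ pair≡ (suc (suc m)) = begin
  Counting.#A a b c d (2 + m)             ≡⟨ Counting.#A-closed a b c d (sym (ℕ.m∸n+n≡m b≤a)) m ⟩
  (a ∸ b) * c * complete d a m            ≡⟨ cong₂ _*_ ec≡e′c′ (complete-unordered pair≡ m) ⟩
  (a′ ∸ b′) * c′ * complete d′ a′ m       ≡⟨ sym (Counting.#A-closed a′ b′ c′ d′ (sym (ℕ.m∸n+n≡m b′≤a′)) m) ⟩
  Counting.#A a′ b′ c′ d′ (2 + m)         ∎
  where open ≡-Reasoning

-- From A to V

size : {F : ℕ → Set} → List (Σ ℕ F) → ℕ
size fs = sum (map proj₁ fs)

Factorisations : (ℕ → Set) → ℕ → Set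
Factorisations F n = Σ (List (Σ ℕ F)) λ fs → size fs ≡ n

Factorisations-≡ : {F : ℕ → Set} {n : ℕ} {fs gs : List (Σ ℕ F)} {p : size fs ≡ n} {q : size gs ≡ n} →
  fs ≡ gs → _≡_ {A = Factorisations F n} (fs , p) (gs , q)
Factorisations-≡ {p = p} {q} refl = cong (_ ,_) (≡-irrelevant p q)

mapFactors : {F G : ℕ → Set} → (∀ {s} → F s → G s) → List (Σ ℕ F) → List (Σ ℕ G)
mapFactors f = map (map₂ f)

size-mapFactors : {F G : ℕ → Set} (f : ∀ {s} → F s → G s) (fs : List (Σ ℕ F)) → size (mapFactors f fs) ≡ size fs
size-mapFactors f fs = cong sum (sym (map-∘ fs))

mapFactors-inverse : {F G : ℕ → Set} {f : ∀ {s} → F s → G s} {g : ∀ {s} → G s → F s} →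
  (∀ {s} (x : F s) → g (f x) ≡ x) → (fs : List (Σ ℕ F)) → mapFactors g (mapFactors f fs) ≡ fs
mapFactors-inverse g∘f fs =
  trans (sym (map-∘ fs)) (trans (map-cong (λ { (s , x) → cong (s ,_) (g∘f x) }) fs) (map-id fs))

Factorisations-cong : {F G : ℕ → Set} → (∀ s → F s ↔ G s) → (n : ℕ) → Factorisations F n ↔ Factorisations G n
Factorisations-cong φ n = mk↔ₛ′ (transport (Inverse.to (φ _))) (transport (Inverse.from (φ _)))
  (λ { (gs , _) → Factorisations-≡ (mapFactors-inverse (Inverse.strictlyInverseˡ (φ _)) gs) })
  (λ { (fs , _) → Factorisations-≡ (mapFactors-inverse (Inverse.strictlyInverseʳ (φ _)) fs) })
  where
  transport : {F G : ℕ → Set} → (∀ {s} → F s → G s) → Factorisations F n → Factorisations G n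
  transport f (fs , size≡n) = mapFactors f fs , trans (size-mapFactors f fs) size≡n

module _ (a b c d : ℕ) where

  Dyck-APath : (x : Σ ℕ (ACopy a b c d)) → Dyck (APath x)
  Dyck-APath (_ , P , _ , prim , _) = isDyck⇒Dyck P (proj₁ (Equivalence.to T-∧ prim))

  length-concatMap-APath : (fs : List (Σ ℕ (ACopy a b c d))) → length (concatMap APath fs) ≡ 2 * size fs
  length-concatMap-APath []                         = refl
  length-concatMap-APath (x@(s , _ , len , _) ∷ fs) =
    trans (length-++ (APath x)) (trans (cong₂ _+_ len (length-concatMap-APath fs)) (sym (ℕ.*-distribˡ-+ 2 s (size fs))))

  VCopy↔Factorisations : (n : ℕ) → VCopy a b c d n ↔ Factorisations (ACopy a b c d) n
  VCopy↔Factorisations n = mk↔ₛ′ to from (λ _ → Factorisations-≡ refl) from∘to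
    where
    to : VCopy a b c d n → Factorisations (ACopy a b c d) n
    to (_ , len , _ , fs , refl) = fs , ℕ.*-cancelˡ-≡ (size fs) n 2 (trans (sym (length-concatMap-APath fs)) len)

    from : Factorisations (ACopy a b c d) n → VCopy a b c d n
    from (fs , size≡n) =
      concatMap APath fs , trans (length-concatMap-APath fs) (cong (2 *_) size≡n) ,
      Dyck⇒isDyck _ (Dyck-concatMap APath Dyck-APath fs) , fs , refl

    VCopy-≡ : ∀ {fs} {len len′ : length (concatMap APath fs) ≡ 2 * n} {dyck dyck′ : T (isDyck (concatMap APath fs))} →
      _≡_ {A = VCopy a b c d n} (concatMap APath fs , len , dyck , fs , refl) (concatMap APath fs , len′ , dyck′ , fs , refl)
    VCopy-≡ {len = len} {len′} {dyck} {dyck′} rewrite ≡-irrelevant len len′ | T-irrelevant dyck dyck′ = refl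

    from∘to : (x : VCopy a b c d n) → from (to x) ≡ x
    from∘to (_ , _ , _ , fs , refl) = VCopy-≡ {fs}

VCopy↔VCopy : {a b c d a′ b′ c′ d′ : ℕ} → b ≤ a → b′ ≤ a′ → (a ∸ b) * c ≡ (a′ ∸ b′) * c′ →
  (d ≡ d′ × a ≡ a′) ⊎ (d ≡ a′ × a ≡ d′) → (n : ℕ) → VCopy a b c d n ↔ VCopy a′ b′ c′ d′ n
VCopy↔VCopy {a} {b} {c} {d} {a′} {b′} {c′} {d′} b≤a b′≤a′ ec≡e′c′ pair≡ n =
  ↔-sym (VCopy↔Factorisations a′ b′ c′ d′ n) ↔-∘ (Factorisations-cong ACopy↔ACopy n ↔-∘ VCopy↔Factorisations a b c d n)
  where
  ACopy↔ACopy : (s : ℕ) → ACopy a b c d s ↔ ACopy a′ b′ c′ d′ s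
  ACopy↔ACopy s = ↔-sym (Counting.ACopy↔Fin a′ b′ c′ d′ s) ↔-∘
    (Fin-cong (#A-determined b≤a b′≤a′ ec≡e′c′ pair≡ s) ↔-∘ Counting.ACopy↔Fin a b c d s)

corollary3p12 : (n : ℕ) →
    (VCopy 4 3 7 2 n ↔ VCopy 2 1 7 4 n) ×
    (VCopy 5 4 4 1 n ↔ VCopy 5 1 1 1 n) ×
    (VCopy 5 1 1 1 n ↔ VCopy 1 0 4 5 n) ×
    (VCopy 5 4 4 1 n ↔ VCopy 1 0 4 5 n) ×
    (VCopy 3 2 8 3 n ↔ VCopy 3 1 4 3 n)
corollary3p12 n =
  VCopy↔VCopy (from-yes (3 ≤? 4)) (from-yes (1 ≤? 2)) refl swapped n ,
  VCopy↔VCopy (from-yes (4 ≤? 5)) (from-yes (1 ≤? 5)) refl (inj₁ (refl , refl)) n ,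
  VCopy↔VCopy (from-yes (1 ≤? 5)) (from-yes (0 ≤? 1)) refl swapped n ,
  VCopy↔VCopy (from-yes (4 ≤? 5)) (from-yes (0 ≤? 1)) refl swapped n ,
  VCopy↔VCopy (from-yes (2 ≤? 3)) (from-yes (1 ≤? 3)) refl (inj₁ (refl , refl)) n
  where
  swapped : ∀ {x y} → (x ≡ y × y ≡ x) ⊎ (x ≡ x × y ≡ y)
  swapped = inj₂ (refl , refl)
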